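{- Let $R$ be a commutative ring and let $F=(F_1,\ldots,F_n)\in R[X_1,\ldots,X_n]^n$ be a polynomial map of the form $F_i=X_i+H_i(X_1,\ldots,X_n)$, $i=1,\ldots,n$, where each $H_i$ has lower degree $\geq 2$. Let $t$ be a new variable and let $\widehat{F}\in (R[t])[X_1,\ldots,X_n]^n$ be defined by $\widehat{F}(X)=t^{ -1}F(tX)=X+t^{ -1}H(tX)$. Let $(P_k)_{k\ge 0}$ be the sequence defined by $P_0(X)=X$, $P_{k+1}=P_k\circ F-P_k$, and let $(Q_k)_{k\ge0}$ be the sequence defined by $Q_0(X)=X$, $Q_{k+1}=Q_k\circ\widehat{F}-Q_k$. Then for every $k\in\mathbb{N}$ we have $Q_k(X)=\widehat{P}_k(X)$, where $\widehat{P}_k(X):=t^{ -1}P_k(tX)$.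
   Context: The lower degree of a polynomial is its order of vanishing at the origin, i.e. the minimal total degree of a monomial appearing in it with nonzero coefficient. For a polynomial map $P$ vanishing at $0$, $t^{ -1}P(tX)$ denotes the polynomial map in $(R[t])[X]^n$ obtained by substituting $tX=(tX_1,\ldots,tX_n)$ and dividing by $t$. -}

module Defs where

import Level
open import Algebra.Bundles using (CommutativeRing)
open import Data.Nat as ℕ using (ℕ; zero; suc; _∸_; _<_)
import Data.Nat.Properties as ℕP
open import Data.Fin using (Fin; zero; suc)
open import Data.Vec as V using (Vec; []; _∷_)
import Data.Vec.Properties as VP
open import Data.List as L using (List; []; _∷_; _++_)
open import Data.Product using (_×_; _,_)
import Data.Product.Properties as PP
open import Data.Bool using (if_then_else_)
open import Relation.Binary.Definitions using (DecidableEquality)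
open import Relation.Nullary.Decidable using (does)

-- A polynomial is a finite formal sum of terms a·m, given as
-- a list; two polynomials are equal (_≋_) iff all coefficients agree.

module Terms {c ℓ} (R : CommutativeRing c ℓ) {M : Set}
             (_≟M_ : DecidableEquality M) (_·_ : M → M → M) (ε : M) where
  open CommutativeRing R using (Carrier; _≈_; _+_; _*_; -_; 0#; 1#)

  Poly : Set c
  Poly = List (Carrier × M)

  coeff : Poly → M → Carrier
  coeff [] m = 0#
  coeff ((a , m′) ∷ p) m = if does (m′ ≟M m) then a + coeff p m else coeff p m

  _≋_ : Poly → Poly → Set ℓ
  p ≋ q = ∀ m → coeff p m ≈ coeff q m

  const : Carrier → Poly
  const a = (a , ε) ∷ []

  oneP : Poly
  oneP = const 1#

  _⊕_ : Poly → Poly → Poly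
  p ⊕ q = p ++ q

  ⊝_ : Poly → Poly
  ⊝ p = L.map (λ { (a , m) → (- a , m) }) p

  _⊖_ : Poly → Poly → Poly
  p ⊖ q = p ⊕ (⊝ q)

  _⊗_ : Poly → Poly → Poly
  p ⊗ q = L.concatMap (λ { (a , m) → L.map (λ { (b , m′) → (a * b , m · m′) }) q }) p

  _^P_ : Poly → ℕ → Poly
  p ^P zero = oneP
  p ^P suc k = p ⊗ (p ^P k)

  monEval : ∀ {k} → Vec ℕ k → (Fin k → Poly) → Poly
  monEval [] G = oneP
  monEval (e ∷ m) G = (G zero ^P e) ⊗ monEval m (λ i → G (suc i))

-- R[X_1..X_n]  and  (R[t])[X_1..X_n]  (the latter with terms a t^j X^m)

module Polynomials {c ℓ} (R : CommutativeRing c ℓ) where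
  open CommutativeRing R using (Carrier; _≈_; _+_; _*_; -_; 0#; 1#)

  Mon : ℕ → Set
  Mon n = Vec ℕ n

  monMul : ∀ {n} → Mon n → Mon n → Mon n
  monMul = V.zipWith ℕ._+_

  monOne : ∀ {n} → Mon n
  monOne = V.replicate _ 0

  deg : ∀ {n} → Mon n → ℕ
  deg = V.sum

  unitMon : ∀ {n} → Fin n → Mon n
  unitMon {suc n} zero = 1 ∷ monOne
  unitMon {suc n} (suc i) = 0 ∷ unitMon i

  TMon : ℕ → Set
  TMon n = ℕ × Mon n

  tmul : ∀ {n} → TMon n → TMon n → TMon n
  tmul (j , m) (j′ , m′) = (j ℕ.+ j′ , monMul m m′)

  tone : ∀ {n} → TMon n
  tone = (0 , monOne)

  module X (n : ℕ) = Terms R {Mon n} (VP.≡-dec ℕP._≟_) monMul monOne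
  module T (n : ℕ) = Terms R {TMon n} (PP.≡-dec ℕP._≟_ (VP.≡-dec ℕP._≟_)) tmul tone

  PolyX : ℕ → Set c
  PolyX n = X.Poly n

  PolyT : ℕ → Set c
  PolyT n = T.Poly n

  _≋X_ : ∀ {n} → PolyX n → PolyX n → Set ℓ
  _≋X_ {n} = X._≋_ n

  _≋T_ : ∀ {n} → PolyT n → PolyT n → Set ℓ
  _≋T_ {n} = T._≋_ n

  varX : ∀ {n} → Fin n → PolyX n
  varX i = (1# , unitMon i) ∷ []

  varT : ∀ {n} → Fin n → PolyT n
  varT i = (1# , (0 , unitMon i)) ∷ []

  tT : ∀ {n} → PolyT n
  tT = (1# , (1 , monOne)) ∷ []

  compX : ∀ {n} → PolyX n → (Fin n → PolyX n) → PolyX n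
  compX {n} p G = L.concatMap (λ { (a , m) → X._⊗_ n (X.const n a) (X.monEval n m G) }) p

  compT : ∀ {n} → PolyT n → (Fin n → PolyT n) → PolyT n
  compT {n} p G = L.concatMap (λ { (a , (j , m)) → T._⊗_ n ((a , (j , monOne)) ∷ []) (T.monEval n m G) }) p

  -- P(tX), as an element of (R[t])[X]
  scaleT : ∀ {n} → PolyX n → PolyT n
  scaleT p = L.map (λ { (a , m) → (a , (deg m , m)) }) p

  -- t^{-1} P(tX): term a X^m ↦ a t^{deg m - 1} X^m.  This is t^{-1}P(tX)
  -- whenever P vanishes at 0 (only used for such P below).
  hat : ∀ {n} → PolyX n → PolyT n
  hat p = L.map (λ { (a , m) → (a , (deg m ∸ 1 , m)) }) p

  LowerDegGe2 : ∀ {n} → PolyX n → Set ℓ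
  LowerDegGe2 {n} p = ∀ (m : Mon n) → deg m < 2 → X.coeff n p m ≈ 0#

  MapX : ℕ → Set c
  MapX n = Fin n → PolyX n

  MapT : ℕ → Set c
  MapT n = Fin n → PolyT n

  Fmap : ∀ {n} → MapX n → MapX n
  Fmap {n} H i = X._⊕_ n (varX i) (H i)

  Fhat : ∀ {n} → MapX n → MapT n
  Fhat {n} H i = T._⊕_ n (varT i) (hat (H i))

  Pseq : ∀ {n} → MapX n → ℕ → MapX n
  Pseq F zero = varX
  Pseq {n} F (suc k) i = X._⊖_ n (compX (Pseq F k i) F) (Pseq F k i)

  Qseq : ∀ {n} → MapT n → ℕ → MapT n
  Qseq G zero = varT
  Qseq {n} G (suc k) i = T._⊖_ n (compT (Qseq G k i) G) (Qseq G k i)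

  mulT : ∀ {n} → PolyT n → PolyT n
  mulT {n} q = T._⊗_ n tT q

module Submission where

-- A polynomial in Defs is a list of terms a·m; for f : M → R
-- write  pair f p = Σ a·f(m)  for the value of the linear functional
-- induced by f.  Pairings with indicator functions recover coefficients,
-- and every operation of Defs (sum, difference, product, power,
-- substitution) has a simple pairing formula, so pairings are the
-- convenient invariant.  For A ∈ (R[t])[X] and B ∈ R[X] define
--     A ≈[ d ] B   ⇔   t^d·A and B(tX) have the same pairings,
-- i.e. t^d·A = B(tX).  This relation is compatible with ⊕, ⊖, ⊗, powers
-- and substitution (adding degrees as expected), X_i ≈[ 1 ] X_i, and
-- t^{-1}H(tX) ≈[ 1 ] H whenever H vanishes at 0; the last step is where
-- the lower-degree hypothesis enters, via the fact that a pairing only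
-- depends on the values of f on the support of the polynomial.  Hence
-- F̂_i ≈[ 1 ] F_i, and induction on k gives Q_k ≈[ 1 ] P_k, which is the
-- theorem  t·Q_k = P_k(tX)  read off coefficientwise.

open import Defs
open import Algebra.Bundles using (CommutativeRing)
open import Data.Nat using (ℕ)
open import Data.Fin using (Fin)

open import Level using (_⊔_)
open import Data.Nat as ℕ using (_∸_)
import Data.Nat.Properties as ℕP
open import Algebra.Properties.CommutativeSemigroup ℕP.+-commutativeSemigroup
  using () renaming (interchange to +-interchange)
open import Data.Fin using (zero; suc)
open import Data.Vec using ([]; _∷_)
import Data.Vec.Properties as VP
import Data.Product.Properties as PP
open import Data.List as L using (List; []; _∷_; _++_)
open import Data.Product using (_×_; _,_; proj₁; proj₂)
open import Data.Sum using (_⊎_; inj₁; inj₂)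
open import Data.Bool using (if_then_else_)
open import Data.Empty using (⊥-elim)
open import Function using (_∘_)
open import Relation.Nullary using (yes; no; ¬_)
open import Relation.Nullary.Decidable using (does)
open import Relation.Binary.Definitions using (DecidableEquality)
open import Relation.Binary.PropositionalEquality as P using (_≡_)

module Pairing {c ℓ} (R : CommutativeRing c ℓ) where
  open CommutativeRing R
  open import Algebra.Properties.Ring ring using (-0#≈0#; -‿+-comm; -‿distribˡ-*)
  open import Relation.Binary.Reasoning.Setoid setoid

  pair : {A : Set} → (A → Carrier) → List (Carrier × A) → Carrier
  pair f [] = 0#
  pair f ((a , m) ∷ p) = a * f m + pair f p

  module _ {A : Set} where

    pair-++ : (f : A → Carrier) (p q : List (Carrier × A)) →
              pair f (p ++ q) ≈ pair f p + pair f q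
    pair-++ f [] q = sym (+-identityˡ _)
    pair-++ f ((a , m) ∷ p) q = trans (+-congˡ (pair-++ f p q)) (sym (+-assoc _ _ _))

    pair-cong : {f g : A → Carrier} → (∀ m → f m ≈ g m) → ∀ p → pair f p ≈ pair g p
    pair-cong f≈g [] = refl
    pair-cong f≈g ((a , m) ∷ p) = +-cong (*-congˡ (f≈g m)) (pair-cong f≈g p)

    pair-cong-≡ : {f g : A → Carrier} → (∀ m → f m ≡ g m) → ∀ p → pair f p ≈ pair g p
    pair-cong-≡ f≡g = pair-cong (λ m → reflexive (f≡g m))

    pair-scale : (a : Carrier) (f : A → Carrier) →
                 ∀ p → pair (λ x → a * f x) p ≈ a * pair f p
    pair-scale a f [] = sym (zeroʳ a)
    pair-scale a f ((b , m) ∷ p) = begin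
        b * (a * f m) + pair (λ x → a * f x) p
      ≈⟨ +-cong (x∙yz≈y∙xz b a (f m)) (pair-scale a f p) ⟩
        a * (b * f m) + a * pair f p
      ≈⟨ distribˡ a _ _ ⟨
        a * (b * f m + pair f p) ∎
      where open import Algebra.Properties.CommutativeSemigroup *-commutativeSemigroup
              using (x∙yz≈y∙xz)

    pair-neg : (f : A → Carrier) → ∀ p →
               pair f (L.map (λ { (a , m) → (- a , m) }) p) ≈ - pair f p
    pair-neg f [] = sym -0#≈0#
    pair-neg f ((a , m) ∷ p) = begin
        - a * f m + pair f (L.map (λ { (a , m) → (- a , m) }) p)
      ≈⟨ +-cong (sym (-‿distribˡ-* a (f m))) (pair-neg f p) ⟩
        - (a * f m) + - pair f p
      ≈⟨ -‿+-comm _ _ ⟩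
        - (a * f m + pair f p) ∎

  module _ {A B : Set} where

    pair-map : (f : B → Carrier) (g : A → Carrier)
               (h : Carrier × A → Carrier × B) →
               (∀ a m → proj₁ (h (a , m)) * f (proj₂ (h (a , m))) ≈ a * g m) →
               ∀ p → pair f (L.map h p) ≈ pair g p
    pair-map f g h term [] = refl
    pair-map f g h term ((a , m) ∷ p) = +-cong (term a m) (pair-map f g h term p)

    pair-concatMap : (f : B → Carrier) (g : A → Carrier)
                     (h : Carrier × A → List (Carrier × B)) →
                     (∀ a m → pair f (h (a , m)) ≈ a * g m) →
                     ∀ p → pair f (L.concatMap h p) ≈ pair g p
    pair-concatMap f g h term [] = refl
    pair-concatMap f g h term ((a , m) ∷ p) =
      trans (pair-++ f (h (a , m)) (L.concatMap h p))
            (+-cong (term a m) (pair-concatMap f g h term p))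

module MonoidPolynomials {c ℓ} (R : CommutativeRing c ℓ) {M : Set}
         (_≟M_ : DecidableEquality M) (_·_ : M → M → M) (ε : M) where
  open CommutativeRing R
  open Pairing R
  open Terms R _≟M_ _·_ ε
  open import Relation.Binary.Reasoning.Setoid setoid

  δ : M → M → Carrier
  δ m μ = if does (μ ≟M m) then 1# else 0#

  coeff-as-pair : ∀ p m → coeff p m ≈ pair (δ m) p
  coeff-as-pair [] m = refl
  coeff-as-pair ((a , μ) ∷ p) m with μ ≟M m
  ... | yes _ = +-cong (sym (*-identityʳ a)) (coeff-as-pair p m)
  ... | no _ = trans (coeff-as-pair p m) (sym (trans (+-congʳ (zeroʳ a)) (+-identityˡ _)))

  pair-⊗ : ∀ (f : M → Carrier) p q →
           pair f (p ⊗ q) ≈ pair (λ μ → pair (λ x → f (μ · x)) q) p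
  pair-⊗ f p q = pair-concatMap f (λ μ → pair (λ x → f (μ · x)) q) _
    (λ a μ → trans (pair-map f (λ x → a * f (μ · x)) _
                      (λ b x → trans (*-congʳ (*-comm a b)) (*-assoc _ _ _)) q)
                   (pair-scale a (λ x → f (μ · x)) q)) p

  pair-⊖ : ∀ (f : M → Carrier) p q → pair f (p ⊖ q) ≈ pair f p + - pair f q
  pair-⊖ f p q = trans (pair-++ f p (⊝ q)) (+-congˡ (pair-neg f q))

  pair-substitute : ∀ (f : M → Carrier) (j : M → M) (k : M → Poly) p →
    pair f (L.concatMap (λ { (a , m) → ((a , j m) ∷ []) ⊗ k m }) p)
      ≈ pair (λ m → pair (λ x → f (j m · x)) (k m)) p
  pair-substitute f j k = pair-concatMap f _ _
    (λ a m → trans (pair-⊗ f ((a , j m) ∷ []) (k m)) (+-identityʳ _))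

  -- A pairing only depends on f on the support of p.  To prove it we
  -- collect all terms with a given monomial μ: without μ p deletes them.
  without : M → Poly → Poly
  without μ [] = []
  without μ ((b , ν) ∷ r) =
    if does (ν ≟M μ) then without μ r else (b , ν) ∷ without μ r

  length-without : ∀ μ r → L.length (without μ r) ℕ.≤ L.length r
  length-without μ [] = ℕ.z≤n
  length-without μ ((b , ν) ∷ r) with ν ≟M μ
  ... | yes _ = ℕP.m≤n⇒m≤1+n (length-without μ r)
  ... | no _ = ℕ.s≤s (length-without μ r)

  length-without-head : ∀ a μ r → L.length (without μ ((a , μ) ∷ r)) ℕ.≤ L.length r
  length-without-head a μ r with μ ≟M μ
  ... | yes _ = length-without μ r
  ... | no μ≢μ = ⊥-elim (μ≢μ P.refl)

  pair-collect : ∀ (f : M → Carrier) μ r →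
                 pair f r ≈ coeff r μ * f μ + pair f (without μ r)
  pair-collect f μ [] = sym (trans (+-congʳ (zeroˡ _)) (+-identityˡ _))
  pair-collect f μ ((b , ν) ∷ r) with ν ≟M μ
  ... | yes P.refl = begin
      b * f ν + pair f r
    ≈⟨ +-congˡ (pair-collect f ν r) ⟩
      b * f ν + (coeff r ν * f ν + pair f (without ν r))
    ≈⟨ +-assoc _ _ _ ⟨
      (b * f ν + coeff r ν * f ν) + pair f (without ν r)
    ≈⟨ +-congʳ (distribʳ _ _ _) ⟨
      (b + coeff r ν) * f ν + pair f (without ν r) ∎
  ... | no _ = begin
      b * f ν + pair f r
    ≈⟨ +-congˡ (pair-collect f μ r) ⟩
      b * f ν + (coeff r μ * f μ + pair f (without μ r))
    ≈⟨ x∙yz≈y∙xz _ _ _ ⟩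
      coeff r μ * f μ + (b * f ν + pair f (without μ r)) ∎
    where open import Algebra.Properties.CommutativeSemigroup +-commutativeSemigroup
            using (x∙yz≈y∙xz)

  coeff-without-same : ∀ μ r → coeff (without μ r) μ ≈ 0#
  coeff-without-same μ [] = refl
  coeff-without-same μ ((b , ν) ∷ r) with ν ≟M μ
  ... | yes _ = coeff-without-same μ r
  ... | no ν≢μ with ν ≟M μ
  ...   | yes ν≡μ = ⊥-elim (ν≢μ ν≡μ)
  ...   | no _ = coeff-without-same μ r

  coeff-without-other : ∀ μ r m → ¬ (m ≡ μ) → coeff (without μ r) m ≈ coeff r m
  coeff-without-other μ [] m m≢μ = refl
  coeff-without-other μ ((b , ν) ∷ r) m m≢μ with ν ≟M μ
  ... | yes P.refl with ν ≟M m
  ...   | yes P.refl = ⊥-elim (m≢μ P.refl)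
  ...   | no _ = coeff-without-other μ r m m≢μ
  coeff-without-other μ ((b , ν) ∷ r) m m≢μ | no _ with ν ≟M m
  ...   | yes _ = +-congˡ (coeff-without-other μ r m m≢μ)
  ...   | no _ = coeff-without-other μ r m m≢μ

  -- f and g agree on the support of p (stated without assuming that
  -- equality in R is decidable).
  AgreeOnSupport : (M → Carrier) → (M → Carrier) → Poly → Set ℓ
  AgreeOnSupport f g p = ∀ m → coeff p m ≈ 0# ⊎ f m ≈ g m

  agree-without : ∀ {f g} μ p → AgreeOnSupport f g p → AgreeOnSupport f g (without μ p)
  agree-without μ p agree m with m ≟M μ
  ... | yes P.refl = inj₁ (coeff-without-same μ p)
  ... | no m≢μ with agree m
  ...   | inj₁ p₀ = inj₁ (trans (coeff-without-other μ p m m≢μ) p₀)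
  ...   | inj₂ f≈g = inj₂ f≈g

  pair-support-cong-bounded : ∀ (f g : M → Carrier) bound p → L.length p ℕ.≤ bound →
                              AgreeOnSupport f g p → pair f p ≈ pair g p
  pair-support-cong-bounded f g bound [] _ _ = refl
  pair-support-cong-bounded f g (ℕ.suc bound) p@((a , μ) ∷ r) (ℕ.s≤s len) agree =
    begin
      pair f p
    ≈⟨ pair-collect f μ p ⟩
      coeff p μ * f μ + pair f (without μ p)
    ≈⟨ +-cong at-μ rest ⟩
      coeff p μ * g μ + pair g (without μ p)
    ≈⟨ pair-collect g μ p ⟨
      pair g p ∎
    where
    at-μ : coeff p μ * f μ ≈ coeff p μ * g μ
    at-μ with agree μ
    ... | inj₁ p₀ = begin
        coeff p μ * f μ  ≈⟨ *-congʳ p₀ ⟩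
        0# * f μ         ≈⟨ zeroˡ _ ⟩
        0#               ≈⟨ zeroˡ _ ⟨
        0# * g μ         ≈⟨ *-congʳ p₀ ⟨
        coeff p μ * g μ  ∎
    ... | inj₂ f≈g = *-congˡ f≈g
    rest : pair f (without μ p) ≈ pair g (without μ p)
    rest = pair-support-cong-bounded f g bound (without μ p)
             (ℕP.≤-trans (length-without-head a μ r) len) (agree-without μ p agree)

  pair-support-cong : ∀ (f g : M → Carrier) p →
                      AgreeOnSupport f g p → pair f p ≈ pair g p
  pair-support-cong f g p = pair-support-cong-bounded f g (L.length p) p ℕP.≤-refl

module Degree {c ℓ} (R : CommutativeRing c ℓ) where
  open Polynomials R

  monMul-identityˡ : ∀ {k} (m : Mon k) → monMul monOne m ≡ m
  monMul-identityˡ = VP.zipWith-identityˡ ℕP.+-identityˡ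

  deg-monOne : ∀ k → deg (monOne {k}) ≡ 0
  deg-monOne ℕ.zero = P.refl
  deg-monOne (ℕ.suc k) = deg-monOne k

  deg-monMul : ∀ {k} (m m′ : Mon k) → deg (monMul m m′) ≡ deg m ℕ.+ deg m′
  deg-monMul [] [] = P.refl
  deg-monMul (x ∷ m) (y ∷ m′) =
    P.trans (P.cong (x ℕ.+ y ℕ.+_) (deg-monMul m m′)) (+-interchange x y (deg m) (deg m′))

  deg-unitMon : ∀ {k} (i : Fin k) → deg (unitMon i) ≡ 1
  deg-unitMon {ℕ.suc k} zero = P.cong ℕ.suc (deg-monOne k)
  deg-unitMon (suc i) = deg-unitMon i

module Scaling {c ℓ} (R : CommutativeRing c ℓ) (n : ℕ) where
  open CommutativeRing R hiding (zero)
  open Pairing R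
  open Polynomials R
  open Degree R
  module MX = MonoidPolynomials R {Mon n} (VP.≡-dec ℕP._≟_) monMul monOne
  module MT =
    MonoidPolynomials R {TMon n} (PP.≡-dec ℕP._≟_ (VP.≡-dec ℕP._≟_)) tmul tone
  open import Relation.Binary.Reasoning.Setoid setoid

  shift : ℕ → TMon n → TMon n
  shift d (j , m) = (d ℕ.+ j , m)

  scaleMon : Mon n → TMon n
  scaleMon m = (deg m , m)

  -- A record rather than a plain function type so that A, d and B can be
  -- inferred from the type.
  infix 4 _≈[_]_
  record _≈[_]_ (A : PolyT n) (d : ℕ) (B : PolyX n) : Set (c ⊔ ℓ) where
    field
      pairings : ∀ (f : TMon n → Carrier) →
                 pair (f ∘ shift d) A ≈ pair (f ∘ scaleMon) B
  open _≈[_]_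

  ≈-one : T.oneP n ≈[ 0 ] X.oneP n
  ≈-one .pairings f =
    reflexive (P.cong (λ d → 1# * f (d , monOne) + 0#) (P.sym (deg-monOne n)))

  ≈-var : ∀ i → varT i ≈[ 1 ] varX i
  ≈-var i .pairings f =
    reflexive (P.cong (λ d → 1# * f (d , unitMon i) + 0#) (P.sym (deg-unitMon i)))

  ≈-⊕ : ∀ {d A A′ B B′} → A ≈[ d ] B → A′ ≈[ d ] B′ →
        T._⊕_ n A A′ ≈[ d ] X._⊕_ n B B′
  ≈-⊕ {d} {A} {A′} {B} {B′} A≈B A′≈B′ .pairings f = begin
      pair (f ∘ shift d) (A ++ A′)
    ≈⟨ pair-++ _ A A′ ⟩
      pair (f ∘ shift d) A + pair (f ∘ shift d) A′
    ≈⟨ +-cong (A≈B .pairings f) (A′≈B′ .pairings f) ⟩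
      pair (f ∘ scaleMon) B + pair (f ∘ scaleMon) B′
    ≈⟨ pair-++ _ B B′ ⟨
      pair (f ∘ scaleMon) (B ++ B′) ∎

  ≈-⊖ : ∀ {d A A′ B B′} → A ≈[ d ] B → A′ ≈[ d ] B′ →
        T._⊖_ n A A′ ≈[ d ] X._⊖_ n B B′
  ≈-⊖ {d} {A} {A′} {B} {B′} A≈B A′≈B′ .pairings f = begin
      pair (f ∘ shift d) (T._⊖_ n A A′)
    ≈⟨ MT.pair-⊖ _ A A′ ⟩
      pair (f ∘ shift d) A + - pair (f ∘ shift d) A′
    ≈⟨ +-cong (A≈B .pairings f) (-‿cong (A′≈B′ .pairings f)) ⟩
      pair (f ∘ scaleMon) B + - pair (f ∘ scaleMon) B′
    ≈⟨ MX.pair-⊖ _ B B′ ⟨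
      pair (f ∘ scaleMon) (X._⊖_ n B B′) ∎

  -- Products: the powers of t add up.  Both shift and scaleMon turn
  -- products of monomials into products (the latter since deg is additive).
  shift-tmul : ∀ d e (y y′ : TMon n) →
               shift (d ℕ.+ e) (tmul y y′) ≡ tmul (shift d y) (shift e y′)
  shift-tmul d e (j , m) (j′ , m′) = P.cong (_, monMul m m′) (+-interchange d e j j′)

  scaleMon-monMul : ∀ m m′ → scaleMon (monMul m m′) ≡ tmul (scaleMon m) (scaleMon m′)
  scaleMon-monMul m m′ = P.cong (_, monMul m m′) (deg-monMul m m′)

  ≈-⊗ : ∀ {d e A A′ B B′} → A ≈[ d ] B → A′ ≈[ e ] B′ →
        T._⊗_ n A A′ ≈[ d ℕ.+ e ] X._⊗_ n B B′
  ≈-⊗ {d} {e} {A} {A′} {B} {B′} A≈B A′≈B′ .pairings f = begin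
      pair (f ∘ shift (d ℕ.+ e)) (T._⊗_ n A A′)
    ≈⟨ MT.pair-⊗ _ A A′ ⟩
      pair (λ y → pair (λ y′ → f (shift (d ℕ.+ e) (tmul y y′))) A′) A
    ≈⟨ pair-cong (λ y → pair-cong-≡ (λ y′ → P.cong f (shift-tmul d e y y′)) A′) A ⟩
      pair (g ∘ shift d) A
    ≈⟨ A≈B .pairings g ⟩
      pair (g ∘ scaleMon) B
    ≈⟨ pair-cong (λ x → A′≈B′ .pairings (f ∘ tmul (scaleMon x))) B ⟩
      pair (λ x → pair (λ x′ → f (tmul (scaleMon x) (scaleMon x′))) B′) B
    ≈⟨ pair-cong (λ x → pair-cong-≡ (λ x′ → P.cong f (scaleMon-monMul x x′)) B′) B ⟨
      pair (λ x → pair (λ x′ → f (scaleMon (monMul x x′))) B′) B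
    ≈⟨ MX.pair-⊗ (f ∘ scaleMon) B B′ ⟨
      pair (f ∘ scaleMon) (X._⊗_ n B B′) ∎
    where
    g : TMon n → Carrier
    g z = pair (λ y′ → f (tmul z (shift e y′))) A′

  ≈-^ : ∀ {A B} → A ≈[ 1 ] B → ∀ e → T._^P_ n A e ≈[ e ] X._^P_ n B e
  ≈-^ A≈B ℕ.zero = ≈-one
  ≈-^ A≈B (ℕ.suc e) = ≈-⊗ A≈B (≈-^ A≈B e)

  ≈-monEval : ∀ {k} (G : Fin k → PolyT n) (F : Fin k → PolyX n) →
              (∀ i → G i ≈[ 1 ] F i) →
              ∀ m → T.monEval n m G ≈[ deg m ] X.monEval n m F
  ≈-monEval G F G≈F [] = ≈-one
  ≈-monEval G F G≈F (e ∷ m) =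
    ≈-⊗ (≈-^ (G≈F zero) e) (≈-monEval (G ∘ suc) (F ∘ suc) (G≈F ∘ suc) m)

  shift-absorbs-t : ∀ d j (y : TMon n) →
                    shift d (tmul (j , monOne) y) ≡ shift (d ℕ.+ j) y
  shift-absorbs-t d j (j′ , m) = P.cong₂ _,_ (P.sym (ℕP.+-assoc d j j′)) (monMul-identityˡ m)

  ≈-compose : ∀ {d A B} {G : MapT n} {F : MapX n} →
              A ≈[ d ] B → (∀ i → G i ≈[ 1 ] F i) → compT A G ≈[ d ] compX B F
  ≈-compose {d} {A} {B} {G} {F} A≈B G≈F .pairings f = begin
      pair (f ∘ shift d) (compT A G)
    ≈⟨ MT.pair-substitute (f ∘ shift d) (λ z → (proj₁ z , monOne)) G-at A ⟩
      pair (λ z → pair (λ y → f (shift d (tmul (proj₁ z , monOne) y))) (G-at z)) A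
    ≈⟨ pair-cong (λ z → pair-cong-≡ (λ y → P.cong f (shift-absorbs-t d (proj₁ z) y)) (G-at z)) A ⟩
      pair (g ∘ shift d) A
    ≈⟨ A≈B .pairings g ⟩
      pair (g ∘ scaleMon) B
    ≈⟨ pair-cong (λ x → ≈-monEval G F G≈F x .pairings f) B ⟩
      pair (λ x → pair (f ∘ scaleMon) (F-at x)) B
    ≈⟨ pair-cong (λ x → pair-cong-≡ (P.cong (f ∘ scaleMon) ∘ monMul-identityˡ) (F-at x)) B ⟨
      pair (λ x → pair (λ y → f (scaleMon (monMul monOne y))) (F-at x)) B
    ≈⟨ MX.pair-substitute (f ∘ scaleMon) (λ _ → monOne) F-at B ⟨
      pair (f ∘ scaleMon) (compX B F) ∎
    where
    G-at : TMon n → PolyT n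
    G-at z = T.monEval n (proj₂ z) G
    F-at : Mon n → PolyX n
    F-at x = X.monEval n x F
    g : TMon n → Carrier
    g z = pair (f ∘ shift (proj₁ z)) (G-at z)

  -- t·(t^{-1}p(tX)) = p(tX) as soon as p has no constant term: the
  -- exponent deg m ∸ 1 used by hat is only wrong for deg m = 0.
  zero-or-suc-pred : ∀ k → k ≡ 0 ⊎ ℕ.suc (k ∸ 1) ≡ k
  zero-or-suc-pred ℕ.zero = inj₁ P.refl
  zero-or-suc-pred (ℕ.suc k) = inj₂ P.refl

  ≈-hat : ∀ {p} → (∀ m → deg m ≡ 0 → X.coeff n p m ≈ 0#) → hat p ≈[ 1 ] p
  ≈-hat {p} vanishes .pairings f = begin
      pair (f ∘ shift 1) (hat p)
    ≈⟨ pair-map _ h _ (λ a m → refl) p ⟩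
      pair h p
    ≈⟨ MX.pair-support-cong h (f ∘ scaleMon) p agree ⟩
      pair (f ∘ scaleMon) p ∎
    where
    h : Mon n → Carrier
    h m = f (ℕ.suc (deg m ∸ 1) , m)
    agree : MX.AgreeOnSupport h (f ∘ scaleMon) p
    agree m with zero-or-suc-pred (deg m)
    ... | inj₁ deg≡0 = inj₁ (vanishes m deg≡0)
    ... | inj₂ suc-pred≡deg =
      inj₂ (reflexive (P.cong (λ d → f (d , m)) suc-pred≡deg))

  ≈-Fhat : ∀ {H : MapX n} → (∀ i → LowerDegGe2 (H i)) →
           ∀ i → Fhat H i ≈[ 1 ] Fmap H i
  ≈-Fhat {H} lowerDeg i = ≈-⊕ (≈-var i) (≈-hat vanishes)
    where
    vanishes : ∀ m → deg m ≡ 0 → X.coeff n (H i) m ≈ 0#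
    vanishes m deg≡0 = lowerDeg i m (P.subst (ℕ._< 2) (P.sym deg≡0) (ℕ.s≤s ℕ.z≤n))

  ≈-coefficients : ∀ {A B} → A ≈[ 1 ] B → mulT A ≋T scaleT B
  ≈-coefficients {A} {B} A≈B m = begin
      T.coeff n (mulT A) m
    ≈⟨ MT.coeff-as-pair (mulT A) m ⟩
      pair (MT.δ m) (mulT A)
    ≈⟨ MT.pair-⊗ (MT.δ m) tT A ⟩
      1# * pair (λ y → MT.δ m (tmul (1 , monOne) y)) A + 0#
    ≈⟨ trans (+-identityʳ _) (*-identityˡ _) ⟩
      pair (λ y → MT.δ m (tmul (1 , monOne) y)) A
    ≈⟨ pair-cong-≡ (λ y → P.cong (MT.δ m) (shift-absorbs-t 0 1 y)) A ⟩
      pair (MT.δ m ∘ shift 1) A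
    ≈⟨ A≈B .pairings (MT.δ m) ⟩
      pair (MT.δ m ∘ scaleMon) B
    ≈⟨ pair-map (MT.δ m) _ _ (λ a x → refl) B ⟨
      pair (MT.δ m) (scaleT B)
    ≈⟨ MT.coeff-as-pair (scaleT B) m ⟨
      T.coeff n (scaleT B) m ∎

lemma2p2 : ∀ {c ℓ} (R : CommutativeRing c ℓ) (n : ℕ) (H : Polynomials.MapX R n)
    → (∀ i → Polynomials.LowerDegGe2 R (H i))
    → ∀ (k : ℕ) (i : Fin n)
    → Polynomials._≋T_ R (Polynomials.mulT R (Polynomials.Qseq R (Polynomials.Fhat R H) k i))
        (Polynomials.scaleT R (Polynomials.Pseq R (Polynomials.Fmap R H) k i))
lemma2p2 R n H lowerDeg k i = ≈-coefficients (Q≈P k i)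
  where
  open Polynomials R
  open Scaling R n
  Q≈P : ∀ k i → Qseq (Fhat H) k i ≈[ 1 ] Pseq (Fmap H) k i
  Q≈P ℕ.zero = ≈-var
  Q≈P (ℕ.suc k) i = ≈-⊖ (≈-compose (Q≈P k i) (≈-Fhat lowerDeg)) (Q≈P k i)
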